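{- Let $s\ge 0$ be an integer and let $c(s)=\max\{3,2s-1\}$. Let $G$ be a bipartite $(sP_1+P_3)$-free graph. If $G$ has a connected component on at least $c(s)$ vertices, then $G$ has at most $s-1$ other connected components, and each of them has at most two vertices.
   Context: All graphs are finite and simple. $P_r$ denotes the path on $r$ vertices; $P_1$ is a single vertex. For graphs $G_1,G_2$, $G_1+G_2$ denotes their disjoint union, and $sG_1$ the disjoint union of $s$ copies of $G_1$; so $sP_1+P_3$ is the disjoint union of $s$ isolated vertices and a path on three vertices (for $s=0$ it is $P_3$). A graph is $H$-free if it contains no induced subgraph isomorphic to $H$. -}

module Defs where

open import Data.Nat using (ℕ; zero; suc; _+_; _*_; _∸_; _⊔_; _≡ᵇ_)

open import Data.Fin using (Fin; toℕ; splitAt; _↑ˡ_; _↑ʳ_)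
open import Data.Bool using (Bool; true; false; _∨_; T)
open import Data.Bool.Properties using (∨-comm)
open import Data.Sum using (_⊎_; inj₁; inj₂)
open import Data.Product using (Σ; ∃; _×_; _,_)
open import Data.Empty using (⊥)
open import Relation.Nullary using (¬_)
open import Relation.Binary.PropositionalEquality using (_≡_; _≢_; refl)
open import Function.Definitions using (Injective)

record Graph (n : ℕ) : Set where
  field
    adj    : Fin n → Fin n → Bool
    adj-sym    : ∀ u v → adj u v ≡ adj v u
    irrefl : ∀ v → adj v v ≡ false
open Graph public

pathAdj : ∀ {r} → Fin r → Fin r → Bool
pathAdj i j = (suc (toℕ i) ≡ᵇ toℕ j) ∨ (suc (toℕ j) ≡ᵇ toℕ i)

private
  sucNotSelf : ∀ m → (suc m ≡ᵇ m) ≡ false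
  sucNotSelf zero = refl
  sucNotSelf (suc m) = sucNotSelf m

Path : (r : ℕ) → Graph r
Path r = record
  { adj = pathAdj
  ; adj-sym = λ i j → ∨-comm (suc (toℕ i) ≡ᵇ toℕ j) (suc (toℕ j) ≡ᵇ toℕ i)
  ; irrefl = λ v → irr (toℕ v) }
  where
  irr : ∀ m → ((suc m ≡ᵇ m) ∨ (suc m ≡ᵇ m)) ≡ false
  irr m rewrite sucNotSelf m = refl

-- Disjoint union G₁ + G₂ (vertices of G₁ first, then those of G₂).
sumAdj : ∀ {m n} → Graph m → Graph n → Fin (m + n) → Fin (m + n) → Bool
sumAdj {m} G H i j with splitAt m i | splitAt m j
... | inj₁ a | inj₁ b = adj G a b
... | inj₂ a | inj₂ b = adj H a b
... | inj₁ _ | inj₂ _ = false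
... | inj₂ _ | inj₁ _ = false

_⊕_ : ∀ {m n} → Graph m → Graph n → Graph (m + n)
_⊕_ {m} G H = record { adj = sumAdj G H ; adj-sym = sy ; irrefl = ir }
  where
  sy : ∀ u v → sumAdj G H u v ≡ sumAdj G H v u
  sy u v with splitAt m u | splitAt m v
  ... | inj₁ a | inj₁ b = Graph.adj-sym G a b
  ... | inj₂ a | inj₂ b = Graph.adj-sym H a b
  ... | inj₁ _ | inj₂ _ = refl
  ... | inj₂ _ | inj₁ _ = refl
  ir : ∀ v → sumAdj G H v v ≡ false
  ir v with splitAt m v
  ... | inj₁ a = Graph.irrefl G a
  ... | inj₂ a = Graph.irrefl H a

copies : ∀ {m} (s : ℕ) → Graph m → Graph (s * m)
copies zero    G = record { adj = λ () ; adj-sym = λ () ; irrefl = λ () }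
copies (suc s) G = G ⊕ copies s G

sP1+P3 : (s : ℕ) → Graph (s * 1 + 3)
sP1+P3 s = copies s (Path 1) ⊕ Path 3

InducedSub : ∀ {k n} → Graph k → Graph n → Set
InducedSub {k} {n} H G =
  Σ (Fin k → Fin n) λ f → Injective _≡_ _≡_ f × (∀ i j → adj G (f i) (f j) ≡ adj H i j)

Free : ∀ {k n} → Graph k → Graph n → Set
Free H G = ¬ InducedSub H G

Bipartite : ∀ {n} → Graph n → Set
Bipartite {n} G = Σ (Fin n → Bool) λ col → ∀ u v → adj G u v ≡ true → col u ≢ col v

-- Connectivity: u and v lie in the same connected component (walk from u to v).
data Reach {n} (G : Graph n) : Fin n → Fin n → Set where
  here : ∀ {u} → Reach G u u
  step : ∀ {u w v} → adj G u w ≡ true → Reach G w v → Reach G u v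

-- The component containing v has at least k vertices.
CompAtLeast : ∀ {n} → Graph n → Fin n → ℕ → Set
CompAtLeast {n} G v k =
  Σ (Fin k → Fin n) λ f → Injective _≡_ _≡_ f × (∀ i → Reach G v (f i))

-- There are at least k components other than the component of v:
-- k vertices, pairwise in different components, none in v's component.
OtherCompsAtLeast : ∀ {n} → Graph n → Fin n → ℕ → Set
OtherCompsAtLeast {n} G v k =
  Σ (Fin k → Fin n) λ g →
    (∀ i → ¬ Reach G v (g i)) × (∀ i j → i ≢ j → ¬ Reach G (g i) (g j))

c : ℕ → ℕ
c s = 3 ⊔ (2 * s ∸ 1)

module Submission where

-- The argument rests on one embedding lemma: if a component contains a
-- "cherry" (a walk a - b - c with a ≠ c), and s independent vertices lie
-- outside that component, then G contains an induced sP₁ + P₃.  In a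
-- bipartite graph the ends of a cherry are non-adjacent, so the cherry is
-- an induced P₃, and vertices of different components are never adjacent.
--
--  * Every component with at least 3 vertices contains a cherry.
--  * s vertices in pairwise different components are independent; so if
--    s components besides that of v existed, the cherry in v's component
--    and these s vertices would give an induced sP₁ + P₃.
--  * Among the at least 2s-1 vertices of v's component one colour class
--    of the bipartition has at least s members, which are independent; so
--    a second component with 3 vertices (hence a cherry) is impossible.

open import Defs
open import Data.Nat using (ℕ; zero; suc; _+_; _*_; _∸_; _≤_; _≤?_; z≤n; s≤s)
open import Data.Nat.Properties
  using (+-suc; *-identityʳ; m≤n⊔m; m≤m⊔n; m≤m+n; +-mono-≤; +-cancelˡ-≤; ≤-trans; ≰⇒>; ≤-pred; 1+n≰n)
open import Data.Fin using (Fin; zero; suc; splitAt; join; inject≤; cast; _≟_)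
open import Data.Fin.Properties using (inject≤-injective; cast-involutive; join-splitAt)
import Data.Fin.Properties as Fin
open import Data.Vec.Functional using (_∷_)
open import Data.Bool using (Bool; true; false)
open import Data.Bool.Properties using (¬-not)
open import Data.Sum using (_⊎_; inj₁; inj₂; [_,_]′)
open import Data.Product using (Σ; _×_; _,_; proj₁; proj₂)
open import Data.Empty using (⊥-elim)
open import Relation.Nullary using (¬_; yes; no)
open import Relation.Binary.PropositionalEquality
  using (_≡_; _≢_; refl; sym; trans; cong; subst)
open import Function using (_∘_)
open import Function.Definitions using (Injective)
open import Function.Consequences.Propositional
  using (inverseʳ⇒injective; strictlyInverseʳ⇒inverseʳ)
import Function.Construct.Composition as Compose

left-inverse⇒injective : ∀ {A B : Set} (f : A → B) (g : B → A) →
                         (∀ x → g (f x) ≡ x) → Injective _≡_ _≡_ f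
left-inverse⇒injective f g inv = inverseʳ⇒injective f (strictlyInverseʳ⇒inverseʳ {f⁻¹ = g} f inv)

cast-injective : ∀ {m k} (eq : m ≡ k) → Injective _≡_ _≡_ (cast eq)
cast-injective eq = left-inverse⇒injective (cast eq) (cast (sym eq)) (cast-involutive (sym eq) eq)

restrict : ∀ {A : Set} {m k} → m ≤ k → (Fin k → A) → Fin m → A
restrict m≤k f i = f (inject≤ i m≤k)

restrict-injective : ∀ {A : Set} {m k} (m≤k : m ≤ k) (f : Fin k → A) →
                     Injective _≡_ _≡_ f → Injective _≡_ _≡_ (restrict m≤k f)
restrict-injective m≤k f f-inj e = inject≤-injective m≤k m≤k _ _ (f-inj e)

three-distinct⇒injective : ∀ {A : Set} (f : Fin 3 → A) →
  f zero ≢ f (suc zero) → f zero ≢ f (suc (suc zero)) → f (suc zero) ≢ f (suc (suc zero)) →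
  Injective _≡_ _≡_ f
three-distinct⇒injective f d01 d02 d12 = inj
  where
  inj : Injective _≡_ _≡_ f
  inj {zero}             {zero}             _ = refl
  inj {suc zero}         {suc zero}         _ = refl
  inj {suc (suc zero)}   {suc (suc zero)}   _ = refl
  inj {zero}             {suc zero}         e = ⊥-elim (d01 e)
  inj {zero}             {suc (suc zero)}   e = ⊥-elim (d02 e)
  inj {suc zero}         {suc (suc zero)}   e = ⊥-elim (d12 e)
  inj {suc zero}         {zero}             e = ⊥-elim (d01 (sym e))
  inj {suc (suc zero)}   {zero}             e = ⊥-elim (d02 (sym e))
  inj {suc (suc zero)}   {suc zero}         e = ⊥-elim (d12 (sym e))

avoid-two : ∀ {n} (f : Fin 3 → Fin n) → Injective _≡_ _≡_ f → (v w : Fin n) →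
            Σ (Fin 3) λ i → f i ≢ v × f i ≢ w
avoid-two f f-inj v w = choose (classify (f zero)) (classify (f (suc zero))) (classify (f (suc (suc zero))))
  where
  Position : Fin _ → Set
  Position x = (x ≢ v × x ≢ w) ⊎ (x ≡ v ⊎ x ≡ w)

  classify : ∀ x → Position x
  classify x with x ≟ v | x ≟ w
  ... | yes x≡v | _       = inj₂ (inj₁ x≡v)
  ... | no _    | yes x≡w = inj₂ (inj₂ x≡w)
  ... | no x≢v  | no x≢w  = inj₁ (x≢v , x≢w)

  distinct : ∀ {i j} → i ≢ j → f i ≢ f j
  distinct i≢j = i≢j ∘ f-inj

  choose : Position (f zero) → Position (f (suc zero)) → Position (f (suc (suc zero))) →
           Σ (Fin 3) λ i → f i ≢ v × f i ≢ w
  choose (inj₁ away) _           _           = zero , away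
  choose (inj₂ _)    (inj₁ away) _           = suc zero , away
  choose (inj₂ _)    (inj₂ _)    (inj₁ away) = suc (suc zero) , away
  choose (inj₂ (inj₁ p)) (inj₂ (inj₁ q)) _   = ⊥-elim (distinct (λ ()) (trans p (sym q)))
  choose (inj₂ (inj₂ p)) (inj₂ (inj₂ q)) _   = ⊥-elim (distinct (λ ()) (trans p (sym q)))
  choose (inj₂ (inj₁ p)) (inj₂ (inj₂ _)) (inj₂ (inj₁ r)) = ⊥-elim (distinct (λ ()) (trans p (sym r)))
  choose (inj₂ (inj₂ p)) (inj₂ (inj₁ _)) (inj₂ (inj₂ r)) = ⊥-elim (distinct (λ ()) (trans p (sym r)))
  choose (inj₂ (inj₁ _)) (inj₂ (inj₂ q)) (inj₂ (inj₂ r)) = ⊥-elim (distinct (λ ()) (trans q (sym r)))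
  choose (inj₂ (inj₂ _)) (inj₂ (inj₁ q)) (inj₂ (inj₁ r)) = ⊥-elim (distinct (λ ()) (trans q (sym r)))

Monochromatic : ∀ {k} → (Fin k → Bool) → Bool → ℕ → Set
Monochromatic {k} col β m = Σ (Fin m → Fin k) λ σ → Injective _≡_ _≡_ σ × (∀ i → col (σ i) ≡ β)

monochromatic-shift : ∀ {k m β} (col : Fin (suc k) → Bool) →
                      Monochromatic (col ∘ suc) β m → Monochromatic col β m
monochromatic-shift col (σ , σ-inj , σ-col) = suc ∘ σ , σ-inj ∘ Fin.suc-injective , σ-col

monochromatic-extend : ∀ {k m} {β : Bool} (col : Fin (suc k) → Bool) → col zero ≡ β →
                       Monochromatic (col ∘ suc) β m → Monochromatic col β (suc m)
monochromatic-extend {β = β} col col0 (σ , σ-inj , σ-col) = τ , τ-inj , τ-col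
  where
  τ = zero ∷ (suc ∘ σ)

  τ-inj : Injective _≡_ _≡_ τ
  τ-inj {zero}  {zero}  _ = refl
  τ-inj {suc i} {suc j} e = cong suc (σ-inj (Fin.suc-injective e))

  τ-col : ∀ i → col (τ i) ≡ β
  τ-col zero    = col0
  τ-col (suc i) = σ-col i

monochromatic-restrict : ∀ {k m m′ β} (col : Fin k → Bool) → m ≤ m′ →
                         Monochromatic col β m′ → Monochromatic col β m
monochromatic-restrict col m≤m′ (σ , σ-inj , σ-col) =
  restrict m≤m′ σ , restrict-injective m≤m′ σ σ-inj , σ-col ∘ λ i → inject≤ i m≤m′

colour-classes : ∀ {k} (col : Fin k → Bool) →
                 Σ ℕ λ a → Σ ℕ λ b → a + b ≡ k × Monochromatic col true a × Monochromatic col false b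
colour-classes {zero} col = 0 , 0 , refl , empty , empty
  where
  empty : ∀ {β} → Monochromatic col β 0
  empty = (λ ()) , (λ { {()} }) , (λ ())
colour-classes {suc k} col with colour-classes (col ∘ suc) | col zero in col0
... | a , b , a+b≡k , trues , falses | true =
  suc a , b , cong suc a+b≡k , monochromatic-extend col col0 trues , monochromatic-shift col falses
... | a , b , a+b≡k , trues , falses | false =
  a , suc b , trans (+-suc a b) (cong suc a+b≡k) , monochromatic-shift col trues , monochromatic-extend col col0 falses

one-part-large : ∀ s a b → 2 * s ∸ 1 ≤ a + b → s ≤ a ⊎ s ≤ b
one-part-large zero      a b _ = inj₁ z≤n
one-part-large (suc s′) a b total with suc s′ ≤? a | suc s′ ≤? b
... | yes s≤a | _       = inj₁ s≤a
... | no _    | yes s≤b = inj₂ s≤b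
... | no s≰a  | no s≰b  = ⊥-elim (1+n≰n (≤-trans (s≤s (m≤m+n s′ 0)) (+-cancelˡ-≤ s′ _ _ sum≤)))
  where
  -- total : s′ + suc (s′ + 0) ≤ a + b, while both parts are at most s′
  sum≤ : s′ + suc (s′ + 0) ≤ s′ + s′
  sum≤ = ≤-trans total (+-mono-≤ (≤-pred (≰⇒> s≰a)) (≤-pred (≰⇒> s≰b)))

large-colour-class : ∀ {k} s (col : Fin k → Bool) → 2 * s ∸ 1 ≤ k → Σ Bool λ β → Monochromatic col β s
large-colour-class s col big with colour-classes col
... | a , b , refl , trues , falses with one-part-large s a b big
...   | inj₁ s≤a = true , monochromatic-restrict col s≤a trues
...   | inj₂ s≤b = false , monochromatic-restrict col s≤b falses

Edgeless : ∀ {m} → Graph m → Set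
Edgeless {m} H = ∀ (x y : Fin m) → adj H x y ≡ false

⊕-edgeless : ∀ {m k} {H₁ : Graph m} {H₂ : Graph k} → Edgeless H₁ → Edgeless H₂ → Edgeless (H₁ ⊕ H₂)
⊕-edgeless {m} e₁ e₂ x y with splitAt m x | splitAt m y
... | inj₁ x₁ | inj₁ y₁ = e₁ x₁ y₁
... | inj₁ _  | inj₂ _  = refl
... | inj₂ _  | inj₁ _  = refl
... | inj₂ x₂ | inj₂ y₂ = e₂ x₂ y₂

copies-edgeless : ∀ {m} {H : Graph m} s → Edgeless H → Edgeless (copies s H)
copies-edgeless zero    _ ()
copies-edgeless (suc s) e = ⊕-edgeless e (copies-edgeless s e)

sP1-edgeless : ∀ s → Edgeless (copies s (Path 1))
sP1-edgeless s = copies-edgeless s λ { zero zero → refl }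

module _ {n : ℕ} (G : Graph n) where

  adj-flip : ∀ {u v} → adj G u v ≡ true → adj G v u ≡ true
  adj-flip {u} {v} uv = trans (adj-sym G v u) uv

  adjacent⇒distinct : ∀ {u v} → adj G u v ≡ true → u ≢ v
  adjacent⇒distinct {u} uv refl with trans (sym uv) (irrefl G u)
  ... | ()

  reach-trans : ∀ {u v w} → Reach G u v → Reach G v w → Reach G u w
  reach-trans here       vw = vw
  reach-trans (step e r) vw = step e (reach-trans r vw)

  reach-sym : ∀ {u v} → Reach G u v → Reach G v u
  reach-sym here       = here
  reach-sym (step e r) = reach-trans (reach-sym r) (step (adj-flip e) here)

  separated : ∀ {u x y} → Reach G u y → ¬ Reach G u x → x ≢ y × adj G x y ≡ false
  separated u⇝y u⇝̸x =
    (λ { refl → u⇝̸x u⇝y }) ,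
    ¬-not λ xy → u⇝̸x (reach-trans u⇝y (step (adj-flip xy) here))

  record IndependentFamily (m : ℕ) : Set where
    field
      member      : Fin m → Fin n
      injective   : Injective _≡_ _≡_ member
      independent : ∀ i j → adj G (member i) (member j) ≡ false
  open IndependentFamily

  representatives-independent : ∀ {m} (o : Fin m → Fin n) →
                                (∀ i j → i ≢ j → ¬ Reach G (o i) (o j)) → IndependentFamily m
  representatives-independent o apart = record
    { member = o ; injective = o-inj ; independent = o-ind }
    where
    o-inj : Injective _≡_ _≡_ o
    o-inj {i} {j} oi≡oj with i ≟ j
    ... | yes i≡j = i≡j
    ... | no i≢j  = ⊥-elim (apart i j i≢j (subst (Reach G (o i)) oi≡oj here))

    o-ind : ∀ i j → adj G (o i) (o j) ≡ false
    o-ind i j with i ≟ j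
    ... | yes refl = irrefl G (o i)
    ... | no i≢j   = ¬-not λ e → apart i j i≢j (step e here)

  same-colour⇒non-adjacent : ((col , _) : Bipartite G) → ∀ {u v} → col u ≡ col v → adj G u v ≡ false
  same-colour⇒non-adjacent (_ , proper) same = ¬-not λ uv → proper _ _ uv same

  -- The larger colour class of a component on at least 2s - 1 vertices
  -- supplies s independent vertices of that component.
  independent-in-component : Bipartite G → ∀ s {k} {v} → 2 * s ∸ 1 ≤ k → CompAtLeast G v k →
                             Σ (IndependentFamily s) λ I → ∀ i → Reach G v (member I i)
  independent-in-component bip@(col , _) s big (g , g-inj , g-reach)
    with large-colour-class s (col ∘ g) big
  ... | β , σ , σ-inj , σ-col = family , g-reach ∘ σ
    where
    family : IndependentFamily s
    family = record
      { member      = g ∘ σ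
      ; injective   = Compose.injective _≡_ _≡_ _≡_ σ-inj g-inj
      ; independent = λ i j → same-colour⇒non-adjacent bip (trans (σ-col i) (sym (σ-col j))) }

  edgeless-induced : ∀ {m} (H : Graph m) → Edgeless H → IndependentFamily m → InducedSub H G
  edgeless-induced H H-edgeless I = member I , injective I , λ i j → trans (independent I i j) (sym (H-edgeless i j))

  ⊕-induced : ∀ {m k} {H₁ : Graph m} {H₂ : Graph k} →
              ((f₁ , _) : InducedSub H₁ G) → ((f₂ , _) : InducedSub H₂ G) →
              (∀ x y → f₁ x ≢ f₂ y × adj G (f₁ x) (f₂ y) ≡ false) → InducedSub (H₁ ⊕ H₂) G
  ⊕-induced {m} {k} {H₁} {H₂} (f₁ , f₁-inj , f₁-adj) (f₂ , f₂-inj , f₂-adj) apart = h , h-inj , h-adj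
    where
    f : Fin m ⊎ Fin k → Fin n
    f = [ f₁ , f₂ ]′

    f-inj : Injective _≡_ _≡_ f
    f-inj {inj₁ x} {inj₁ y} e = cong inj₁ (f₁-inj e)
    f-inj {inj₂ x} {inj₂ y} e = cong inj₂ (f₂-inj e)
    f-inj {inj₁ x} {inj₂ y} e = ⊥-elim (proj₁ (apart x y) e)
    f-inj {inj₂ x} {inj₁ y} e = ⊥-elim (proj₁ (apart y x) (sym e))

    h : Fin (m + k) → Fin n
    h = f ∘ splitAt m

    h-inj : Injective _≡_ _≡_ h
    h-inj = Compose.injective _≡_ _≡_ _≡_
              (left-inverse⇒injective (splitAt m) (join m k) (join-splitAt m k)) f-inj

    h-adj : ∀ i j → adj G (h i) (h j) ≡ adj (H₁ ⊕ H₂) i j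
    h-adj i j with splitAt m i | splitAt m j
    ... | inj₁ x | inj₁ y = f₁-adj x y
    ... | inj₁ x | inj₂ y = proj₂ (apart x y)
    ... | inj₂ x | inj₁ y = trans (adj-sym G (f₂ x) (f₁ y)) (proj₂ (apart y x))
    ... | inj₂ x | inj₂ y = f₂-adj x y

  -- A cherry in the component of u: a walk left - centre - right with
  -- distinct ends (not necessarily induced).
  record Cherry (u : Fin n) : Set where
    field
      left centre right : Fin n
      left~centre   : adj G left centre ≡ true
      centre~right  : adj G centre right ≡ true
      ends-distinct : left ≢ right
      reach-centre  : Reach G u centre

  cherry-across : ∀ {u w} → adj G u w ≡ true → Cherry w → Cherry u
  cherry-across uw C = record
    { left = left ; centre = centre ; right = right ; left~centre = left~centre
    ; centre~right = centre~right ; ends-distinct = ends-distinct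
    ; reach-centre = step uw reach-centre }
    where open Cherry C

  -- If u has a neighbour w and reaches a vertex t ∉ {u, w}, then the first
  -- step of a walk from u to t either leaves to a vertex other than w (giving
  -- the cherry w - u - u′), or goes to w and the argument repeats from w.
  cherry-from-walk : ∀ {u t w} → Reach G u t → adj G w u ≡ true → t ≢ u → t ≢ w → Cherry u
  cherry-from-walk here _ t≢u _ = ⊥-elim (t≢u refl)
  cherry-from-walk {u} {t} {w} (step {w = u′} uu′ u′⇝t) wu t≢u t≢w with u′ ≟ w
  ... | yes refl = cherry-across uu′ (cherry-from-walk u′⇝t uu′ t≢w t≢u)
  ... | no u′≢w  = record
    { left = w ; centre = u ; right = u′ ; left~centre = wu ; centre~right = uu′
    ; ends-distinct = u′≢w ∘ sym ; reach-centre = here }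

  cherry-in-component : ∀ {u} → CompAtLeast G u 3 → Cherry u
  cherry-in-component {u} (f , f-inj , f-reach) with avoid-two f f-inj u u
  ... | i , fi≢u , _ = from-first-step (f-reach i) fi≢u
    where
    -- Leave u along an edge u - w, then find a vertex of the three outside {u, w}.
    from-first-step : ∀ {t} → Reach G u t → t ≢ u → Cherry u
    from-first-step here t≢u = ⊥-elim (t≢u refl)
    from-first-step (step {w = w} uw _) _ with avoid-two f f-inj u w
    ... | j , fj≢u , fj≢w = cherry-from-walk (f-reach j) (adj-flip uw) fj≢u fj≢w

  corners : ∀ {u} → Cherry u → Fin 3 → Fin n
  corners C zero             = Cherry.left C
  corners C (suc zero)       = Cherry.centre C
  corners C (suc (suc zero)) = Cherry.right C

  corners-reach : ∀ {u} (C : Cherry u) (y : Fin 3) → Reach G u (corners C y)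
  corners-reach C zero             = reach-trans (Cherry.reach-centre C) (step (adj-flip (Cherry.left~centre C)) here)
  corners-reach C (suc zero)       = Cherry.reach-centre C
  corners-reach C (suc (suc zero)) = reach-trans (Cherry.reach-centre C) (step (Cherry.centre~right C) here)

  -- In a bipartite graph both ends of a cherry get the colour opposite to the
  -- centre, so they are non-adjacent and the cherry is an induced P₃.
  cherry-induced : ∀ {u} → Bipartite G → (C : Cherry u) → InducedSub (Path 3) G
  cherry-induced bip@(col , proper) C = corners C , corners-inj , corners-adj
    where
    open Cherry C

    left≁right : adj G left right ≡ false
    left≁right = same-colour⇒non-adjacent bip
      (trans (¬-not (proper _ _ left~centre)) (sym (¬-not (proper _ _ (adj-flip centre~right)))))

    corners-inj : Injective _≡_ _≡_ (corners C)
    corners-inj = three-distinct⇒injective (corners C)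
      (adjacent⇒distinct left~centre) ends-distinct (adjacent⇒distinct centre~right)

    corners-adj : ∀ x y → adj G (corners C x) (corners C y) ≡ adj (Path 3) x y
    corners-adj zero             zero             = irrefl G left
    corners-adj zero             (suc zero)       = left~centre
    corners-adj zero             (suc (suc zero)) = left≁right
    corners-adj (suc zero)       zero             = adj-flip left~centre
    corners-adj (suc zero)       (suc zero)       = irrefl G centre
    corners-adj (suc zero)       (suc (suc zero)) = centre~right
    corners-adj (suc (suc zero)) zero             = trans (adj-sym G right left) left≁right
    corners-adj (suc (suc zero)) (suc zero)       = adj-flip centre~right
    corners-adj (suc (suc zero)) (suc (suc zero)) = irrefl G right

  sP1+P3-induced : ∀ {s u} → Bipartite G → (I : IndependentFamily s) →
                   (∀ i → ¬ Reach G u (member I i)) → Cherry u → InducedSub (sP1+P3 s) G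
  sP1+P3-induced {s} bip I away C =
    ⊕-induced (edgeless-induced (copies s (Path 1)) (sP1-edgeless s) I′) (cherry-induced bip C)
      λ x y → separated (corners-reach C y) (away (cast (*-identityʳ s) x))
    where
    -- The family reindexed by Fin (s * 1), the vertex set of sP₁.
    I′ : IndependentFamily (s * 1)
    I′ = record
      { member      = member I ∘ cast (*-identityʳ s)
      ; injective   = cast-injective (*-identityʳ s) ∘ injective I
      ; independent = λ i j → independent I _ _ }

3≤c : ∀ s → 3 ≤ c s
3≤c s = m≤m⊔n 3 (2 * s ∸ 1)

2s-1≤c : ∀ s → 2 * s ∸ 1 ≤ c s
2s-1≤c s = m≤n⊔m 3 (2 * s ∸ 1)

component-restrict : ∀ {n m k} (G : Graph n) {v : Fin n} → m ≤ k → CompAtLeast G v k → CompAtLeast G v m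
component-restrict G m≤k (f , f-inj , f-reach) =
  restrict m≤k f , restrict-injective m≤k f f-inj , f-reach ∘ λ i → inject≤ i m≤k

lemma2 : (s : ℕ) {n : ℕ} (G : Graph n) → Bipartite G → Free (sP1+P3 s) G →
    (v : Fin n) → CompAtLeast G v (c s) →
    ¬ OtherCompsAtLeast G v s
    × ((u : Fin n) → ¬ Reach G v u → ¬ CompAtLeast G u 3)
lemma2 s {n} G bip free v big = few-other-components , other-components-small
  where
  -- s further components: their representatives and a cherry at v give sP₁ + P₃.
  few-other-components : ¬ OtherCompsAtLeast G v s
  few-other-components (o , away , apart) =
    free (sP1+P3-induced G bip (representatives-independent G o apart) away
            (cherry-in-component G (component-restrict G (3≤c s) big)))

  -- A colour class of v's component and a cherry in u's component give sP₁ + P₃.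
  other-components-small : (u : Fin n) → ¬ Reach G v u → ¬ CompAtLeast G u 3
  other-components-small u v⇝̸u u-big with independent-in-component G bip s (2s-1≤c s) big
  ... | I , v⇝I = free (sP1+P3-induced G bip I away (cherry-in-component G u-big))
    where
    away : ∀ i → ¬ Reach G u (IndependentFamily.member I i)
    away i u⇝Ii = v⇝̸u (reach-trans G (v⇝I i) (reach-sym G u⇝Ii))
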